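{- Let $\mathcal{F}$ be a union-closed family of finite sets with $\emptyset\in\mathcal{F}$ and let $U\subseteq\bigcup\mathcal{F}$. Then $\mathcal{F}$ is an extension of $(\mathcal{N}^3_{\mathcal{F}}(U),U)$; that is, there is a nonempty union-closed family $\mathcal{H}$ with $(\bigcup\mathcal{H})\cap U=\emptyset$ and $\mathcal{F}=\{A\cup B:A\in\mathcal{N}^3_{\mathcal{F}}(U),B\in\mathcal{H}\}$.
   Context: $J(\mathcal{F})$ is the set of union generators of $\mathcal{F}$: the nonempty $V\in\mathcal{F}$ not equal to the union of the members of $\mathcal{F}$ properly contained in $V$. For a set $W$, $\mathcal{N}_{\mathcal{F}}(W)$ is the family of all unions of subfamilies of $\{V\in J(\mathcal{F}):V\cap W\neq\emptyset\}$ (the empty union being $\emptyset$), and $\mathcal{N}^3_{\mathcal{F}}(U)=\mathcal{N}_{\mathcal{F}}\big(\bigcup\mathcal{N}_{\mathcal{F}}(U)\big)$. -}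

module Defs where

open import Level using (Level; _⊔_; suc; zero)
open import Data.Nat using (ℕ)
open import Data.Fin using (Fin)
open import Data.Fin.Subset using (Subset; _∈_; _⊆_; _⊂_; _∪_; _∩_; Nonempty)
open import Data.Product using (Σ; _×_; ∃)
open import Relation.Nullary using (¬_)

Family : ℕ → (ℓ : Level) → Set (Level.suc ℓ)
Family n ℓ = Subset n → Set ℓ

private
  variable
    n : ℕ
    ℓ ℓ′ : Level

_∈⋃_ : Fin n → Family n ℓ → Set ℓ
x ∈⋃ 𝒢 = ∃ λ A → 𝒢 A × x ∈ A

IsUnionOf : Family n ℓ → Subset n → Set ℓ
IsUnionOf 𝒢 V = ∀ x → (x ∈ V → x ∈⋃ 𝒢) × (x ∈⋃ 𝒢 → x ∈ V)

UnionClosed : Family n ℓ → Set ℓ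
UnionClosed 𝒢 = ∀ A B → 𝒢 A → 𝒢 B → 𝒢 (A ∪ B)

J : Family n ℓ → Family n ℓ
J 𝓕 V = 𝓕 V × Nonempty V × ¬ IsUnionOf (λ A → 𝓕 A × A ⊂ V) V

N : Family n ℓ → Subset n → Family n (Level.suc ℓ)
N {ℓ = ℓ} 𝓕 W A =
  Σ (Family _ ℓ) λ 𝒢 →
    (∀ V → 𝒢 V → J 𝓕 V × Nonempty (V ∩ W)) × IsUnionOf 𝒢 A

-- Every member C of 𝓕 is the union of the union generators it contains.  Splitting
-- these generators into those that meet W and those that do not writes C as A ∪ B,
-- where A ∈ 𝒩_𝓕(W) and B is a member of 𝓕 disjoint from W.  So 𝓕 is the join of
-- 𝒩_𝓕(W) with ℋ = {B ∈ 𝓕 : B ∩ W = ∅}; and ℋ avoids U because U ⊆ W whenever U is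
-- covered by 𝓕, since each point of U lies in a generator meeting U.
module Submission where

open import Defs
open import Level using (Level; 0ℓ; _⊔_; Lift; lift)
open import Data.Nat using (ℕ)
open import Data.Fin using (Fin)
open import Data.Fin.Properties using (all?)
open import Data.Fin.Subset using (Subset; _∈_; _⊆_; _⊂_; _∪_; _∩_; ⊥; Nonempty; Empty)
open import Data.Fin.Subset.Properties
  using (_∈?_; _⊂?_; _⊆?_; nonempty?; anySubset?; ⊆-antisym; ⊥⊆; p⊆p∪q; q⊆p∪q;
         x∈p∪q⁺; x∈p∪q⁻; x∈p∩q⁺; x∈p∩q⁻; ∉⊥)
open import Data.Fin.Subset.Induction using (⊂-wellFounded)
open import Data.List using (List; []; _∷_; allFin)
open import Data.List.Relation.Unary.Any using (here; there)
open import Data.List.Membership.Propositional using () renaming (_∈_ to _∈ₗ_)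
open import Data.List.Membership.Propositional.Properties using (∈-allFin)
open import Data.Product using (Σ; _×_; ∃; _,_; proj₁; proj₂)
open import Data.Sum using (inj₁; inj₂; [_,_])
open import Data.Vec using (tabulate)
open import Data.Vec.Properties using (lookup∘tabulate; lookup⇒[]=; []=⇒lookup)
open import Function using (_∘_)
open import Induction.WellFounded using (Acc; acc)
open import Relation.Binary.PropositionalEquality using (_≡_; refl; sym; trans; subst)
open import Relation.Nullary using (¬_; Dec; yes; no; does; contradiction)
open import Relation.Nullary.Decidable using (_×-dec_; _→-dec_; ¬?; dec-true)
open import Relation.Unary using (Pred; Decidable)

private
  variable
    n : ℕ
    ℓ ℓ′ : Level

fromDec : {P : Pred (Fin n) ℓ} → Decidable P → Subset n
fromDec P? = tabulate (does ∘ P?)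

module _ {P : Pred (Fin n) ℓ} (P? : Decidable P) {x : Fin n} where

  ∈-fromDec⁺ : P x → x ∈ fromDec P?
  ∈-fromDec⁺ px = lookup⇒[]= x _ (trans (lookup∘tabulate _ x) (dec-true (P? x) px))

  ∈-fromDec⁻ : x ∈ fromDec P? → P x
  ∈-fromDec⁻ x∈ with P? x | trans (sym (lookup∘tabulate _ x)) ([]=⇒lookup x∈)
  ... | yes px | _ = px
  ... | no _   | ()

module _ {𝒢 : Family n ℓ} where

  ∈⋃? : Decidable 𝒢 → (x : Fin n) → Dec (x ∈⋃ 𝒢)
  ∈⋃? 𝒢? x = anySubset? (λ V → 𝒢? V ×-dec x ∈? V)

  ⋃ : Decidable 𝒢 → Subset n
  ⋃ 𝒢? = fromDec (∈⋃? 𝒢?)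

  ⋃-isUnionOf : (𝒢? : Decidable 𝒢) → IsUnionOf 𝒢 (⋃ 𝒢?)
  ⋃-isUnionOf 𝒢? x = ∈-fromDec⁻ (∈⋃? 𝒢?) , ∈-fromDec⁺ (∈⋃? 𝒢?)

  isUnionOf? : Decidable 𝒢 → Decidable (IsUnionOf 𝒢)
  isUnionOf? 𝒢? A = all? λ x →
    ((x ∈? A) →-dec ∈⋃? 𝒢? x) ×-dec (∈⋃? 𝒢? x →-dec (x ∈? A))

  member⊆union : ∀ {A V} → IsUnionOf 𝒢 A → 𝒢 V → V ⊆ A
  member⊆union A=⋃𝒢 𝒢V {x} x∈V = proj₂ (A=⋃𝒢 x) (_ , 𝒢V , x∈V)

  union⊆ : ∀ {A C} → (∀ V → 𝒢 V → V ⊆ C) → IsUnionOf 𝒢 A → A ⊆ C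
  union⊆ 𝒢⊆C A=⋃𝒢 {x} x∈A with proj₁ (A=⋃𝒢 x) x∈A
  ... | V , 𝒢V , x∈V = 𝒢⊆C V 𝒢V x∈V

module _ {𝓕 : Family n ℓ} (𝓕-∪ : UnionClosed 𝓕) (𝓕⊥ : 𝓕 ⊥) where

  module _ {𝒢 : Family n ℓ′} {A} (𝒢⊆𝓕 : ∀ V → 𝒢 V → 𝓕 V) (A=⋃𝒢 : IsUnionOf 𝒢 A) where

    member-below-covering : (xs : List (Fin n)) →
      ∃ λ S → 𝓕 S × S ⊆ A × (∀ {x} → x ∈ₗ xs → x ∈ A → x ∈ S)
    member-below-covering [] = ⊥ , 𝓕⊥ , ⊥⊆ , λ ()
    member-below-covering (y ∷ ys) with member-below-covering ys | y ∈? A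
    ... | S , 𝓕S , S⊆A , covers | no y∉A = S , 𝓕S , S⊆A , covers′
      where
      covers′ : ∀ {x} → x ∈ₗ y ∷ ys → x ∈ A → x ∈ S
      covers′ (here refl) y∈A = contradiction y∈A y∉A
      covers′ (there x∈ys) = covers x∈ys
    ... | S , 𝓕S , S⊆A , covers | yes y∈A with proj₁ (A=⋃𝒢 y) y∈A
    ...   | V , 𝒢V , y∈V = V ∪ S , 𝓕-∪ V S (𝒢⊆𝓕 V 𝒢V) 𝓕S , V∪S⊆A , covers′
      where
      V∪S⊆A : V ∪ S ⊆ A
      V∪S⊆A z∈V∪S = [ member⊆union A=⋃𝒢 𝒢V , S⊆A ] (x∈p∪q⁻ V S z∈V∪S)
      covers′ : ∀ {x} → x ∈ₗ y ∷ ys → x ∈ A → x ∈ V ∪ S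
      covers′ (here refl) _ = p⊆p∪q S y∈V
      covers′ (there x∈ys) x∈A = q⊆p∪q V S (covers x∈ys x∈A)

    -- Since the ground set is finite, closure under binary unions and ∅ ∈ 𝓕 already
    -- give closure under arbitrary unions.
    unionClosed⇒⋃-closed : 𝓕 A
    unionClosed⇒⋃-closed with member-below-covering (allFin n)
    ... | S , 𝓕S , S⊆A , covers = subst 𝓕 (⊆-antisym S⊆A (covers (∈-allFin _))) 𝓕S

  N⊆𝓕 : ∀ {W A} → N 𝓕 W A → 𝓕 A
  N⊆𝓕 (𝒢 , 𝒢⊆J , A=⋃𝒢) = unionClosed⇒⋃-closed (λ V → proj₁ ∘ proj₁ ∘ 𝒢⊆J V) A=⋃𝒢

module _ {𝓕 : Family n ℓ} (𝓕? : Decidable 𝓕) where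

  J? : Decidable (J 𝓕)
  J? V = 𝓕? V ×-dec (nonempty? V ×-dec ¬? (isUnionOf? properMember? V))
    where
    properMember? : Decidable (λ A → 𝓕 A × A ⊂ V)
    properMember? A = 𝓕? A ×-dec (A ⊂? V)

  -- A ⊂-minimal member of 𝓕 containing x and below C is a union generator.
  generator-below : ∀ {C x} → 𝓕 C → x ∈ C → ∃ λ V → J 𝓕 V × V ⊆ C × x ∈ V
  generator-below {C} = go (⊂-wellFounded C)
    where
    go : ∀ {C x} → Acc _⊂_ C → 𝓕 C → x ∈ C → ∃ λ V → J 𝓕 V × V ⊆ C × x ∈ V
    go {C} {x} (acc rec) 𝓕C x∈C
      with anySubset? (λ A → (𝓕? A ×-dec (A ⊂? C)) ×-dec (x ∈? A))
    ... | no ∄A =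
      C , (𝓕C , (x , x∈C) , λ C=⋃ → ∄A (proj₁ (C=⋃ x) x∈C)) , (λ x∈C → x∈C) , x∈C
    ... | yes (A , (𝓕A , A⊂C) , x∈A) with go (rec A⊂C) 𝓕A x∈A
    ...   | V , JV , V⊆A , x∈V = V , JV , proj₁ A⊂C ∘ V⊆A , x∈V

  ∈⋃N : ∀ {W x} → x ∈ W → x ∈⋃ 𝓕 → x ∈⋃ N 𝓕 W
  ∈⋃N {W} {x} x∈W (C , 𝓕C , x∈C) with generator-below 𝓕C x∈C
  ... | V , JV , _ , x∈V = V , (single , single⊆J , V=⋃single) , x∈V
    where
    single : Family n ℓ
    single V′ = Lift ℓ (V′ ≡ V)
    single⊆J : ∀ V′ → single V′ → J 𝓕 V′ × Nonempty (V′ ∩ W)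
    single⊆J _ (lift refl) = JV , x , x∈p∩q⁺ (x∈V , x∈W)
    V=⋃single : IsUnionOf single V
    V=⋃single y = (λ y∈V → V , lift refl , y∈V) , λ { (_ , lift refl , y∈V) → y∈V }

avoiding : Family n ℓ → Subset n → Family n ℓ
avoiding 𝓕 W B = 𝓕 B × Empty (B ∩ W)

_⊕_ : Family n ℓ → Family n ℓ′ → Family n (ℓ ⊔ ℓ′)
(𝒜 ⊕ ℬ) C = ∃ λ A → ∃ λ B → 𝒜 A × ℬ B × C ≡ A ∪ B

avoiding-unionClosed : ∀ {𝓕 : Family n ℓ} {W} → UnionClosed 𝓕 → UnionClosed (avoiding 𝓕 W)
avoiding-unionClosed {W = W} 𝓕-∪ A B (𝓕A , A∩W=∅) (𝓕B , B∩W=∅) =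
  𝓕-∪ A B 𝓕A 𝓕B , λ (x , x∈) → let (x∈A∪B , x∈W) = x∈p∩q⁻ _ W x∈ in
    [ (λ x∈A → A∩W=∅ (x , x∈p∩q⁺ (x∈A , x∈W)))
    , (λ x∈B → B∩W=∅ (x , x∈p∩q⁺ (x∈B , x∈W))) ] (x∈p∪q⁻ A B x∈A∪B)

module _ {𝓕 : Family n ℓ} (𝓕? : Decidable 𝓕) (𝓕-∪ : UnionClosed 𝓕) (𝓕⊥ : 𝓕 ⊥)
         (W : Subset n) where

  𝓕⊆N⊕avoiding : ∀ {C} → 𝓕 C → (N 𝓕 W ⊕ avoiding 𝓕 W) C
  𝓕⊆N⊕avoiding {C} 𝓕C =
    A , B , (meeting , (λ V (JV , V∩W≠∅ , _) → JV , V∩W≠∅) , A=⋃) ,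
    (𝓕B , B∩W=∅) , ⊆-antisym C⊆A∪B A∪B⊆C
    where
    meeting missing : Family n ℓ
    meeting V = J 𝓕 V × Nonempty (V ∩ W) × V ⊆ C
    missing V = 𝓕 V × Empty (V ∩ W) × V ⊆ C
    meeting? : Decidable meeting
    meeting? V = J? 𝓕? V ×-dec (nonempty? (V ∩ W) ×-dec (V ⊆? C))
    missing? : Decidable missing
    missing? V = 𝓕? V ×-dec (¬? (nonempty? (V ∩ W)) ×-dec (V ⊆? C))
    A B : Subset n
    A = ⋃ meeting?
    B = ⋃ missing?
    A=⋃ : IsUnionOf meeting A
    A=⋃ = ⋃-isUnionOf meeting?
    B=⋃ : IsUnionOf missing B
    B=⋃ = ⋃-isUnionOf missing?
    𝓕B : 𝓕 B
    𝓕B = unionClosed⇒⋃-closed 𝓕-∪ 𝓕⊥ (λ V → proj₁) B=⋃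
    B∩W=∅ : Empty (B ∩ W)
    B∩W=∅ (x , x∈B∩W) with x∈p∩q⁻ B W x∈B∩W
    ... | x∈B , x∈W with proj₁ (B=⋃ x) x∈B
    ...   | V , (_ , V∩W=∅ , _) , x∈V = V∩W=∅ (x , x∈p∩q⁺ (x∈V , x∈W))
    C⊆A∪B : C ⊆ A ∪ B
    C⊆A∪B {x} x∈C with generator-below 𝓕? 𝓕C x∈C
    ... | V , JV , V⊆C , x∈V with nonempty? (V ∩ W)
    ...   | yes V∩W≠∅ = x∈p∪q⁺ (inj₁ (proj₂ (A=⋃ x) (V , (JV , V∩W≠∅ , V⊆C) , x∈V)))
    ...   | no V∩W=∅ = x∈p∪q⁺ (inj₂ (proj₂ (B=⋃ x) (V , (proj₁ JV , V∩W=∅ , V⊆C) , x∈V)))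
    A∪B⊆C : A ∪ B ⊆ C
    A∪B⊆C x∈A∪B = [ union⊆ (λ V → proj₂ ∘ proj₂) A=⋃ , union⊆ (λ V → proj₂ ∘ proj₂) B=⋃ ]
                    (x∈p∪q⁻ A B x∈A∪B)

lemma3p11 : (n : ℕ) (𝓕 : Family n 0ℓ) → Decidable 𝓕 → UnionClosed 𝓕 → 𝓕 ⊥
    → (U : Subset n) → (∀ x → x ∈ U → x ∈⋃ 𝓕)
    → (W : Subset n) → IsUnionOf (N 𝓕 U) W
    → Σ (Family n 0ℓ) λ ℋ →
        (∃ λ B → ℋ B) × UnionClosed ℋ
        × (∀ x → x ∈ U → ¬ (x ∈⋃ ℋ))
        × (∀ C → (𝓕 C → ∃ λ A → ∃ λ B → N 𝓕 W A × ℋ B × C ≡ A ∪ B)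
                × (∃ (λ A → ∃ λ B → N 𝓕 W A × ℋ B × C ≡ A ∪ B) → 𝓕 C))
lemma3p11 _ 𝓕 𝓕? 𝓕-∪ 𝓕⊥ U U⊆⋃𝓕 W W=⋃N =
  avoiding 𝓕 W ,
  (⊥ , 𝓕⊥ , λ (_ , x∈⊥∩W) → ∉⊥ (proj₁ (x∈p∩q⁻ ⊥ W x∈⊥∩W))) ,
  avoiding-unionClosed 𝓕-∪ ,
  (λ x x∈U (B , (_ , B∩W=∅) , x∈B) → B∩W=∅ (x , x∈p∩q⁺ (x∈B , U⊆W x∈U))) ,
  λ C → 𝓕⊆N⊕avoiding 𝓕? 𝓕-∪ 𝓕⊥ W , N⊕avoiding⊆𝓕
  where
  U⊆W : U ⊆ W
  U⊆W {x} x∈U = proj₂ (W=⋃N x) (∈⋃N 𝓕? x∈U (U⊆⋃𝓕 x x∈U))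
  N⊕avoiding⊆𝓕 : ∀ {C} → (N 𝓕 W ⊕ avoiding 𝓕 W) C → 𝓕 C
  N⊕avoiding⊆𝓕 (A , B , NA , (𝓕B , _) , refl) = 𝓕-∪ A B (N⊆𝓕 𝓕-∪ 𝓕⊥ NA) 𝓕B
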